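{- (Euclidean Principle.) Let $A,B\subseteq\mathbb{N}$ with $B\subset A$ (proper inclusion). Then $m(B)<m(A)$.
   Context: Conway's surreal numbers form an ordered field; $\omega=\{0,1,2,\dots\mid\ \}$ is the first infinite surreal number. An omnific integer is a surreal number $x$ with $x=\{x-1\mid x+1\}$; the surnatural numbers $\mathbf{Nn}$ are the omnific integers $\ge 0$. $\mathbb{N}=\{1,2,\dots\}\subseteq\mathbf{Nn}$, $\mathbb{N}_0=\mathbb{N}\cup\{0\}$, $\omega\in\mathbf{Nn}$. For $A\subseteq\mathbb{N}$, $\kappa_A(n)=|A\cap\{1,\dots,n\}|$ is its counting sequence. Axiom of Extension (assumed throughout): every nondecreasing function $f:\mathbb{N}\to\mathbb{N}_0$ has an extension $\hat f:\mathbf{Nn}\to\mathbf{Nn}$ agreeing with $f$ on $\mathbb{N}$, such that for nondecreasing $f,g$: if $f(n)=g(n)$ for all sufficiently large $n$ then $\hat f(\nu)=\hat g(\nu)$ for all $\nu\in\mathbf{Nn}\setminus\mathbb{N}$; if $f(n)<g(n)$ for all sufficiently large $n$ then $\hat f(\nu)<\hat g(\nu)$ for all $\nu\in\mathbf{Nn}\setminus\mathbb{N}$; and $\widehat{f+g}=\hat f+\hat g$, $\widehat{f\cdot g}=\hat f\cdot\hat g$, $\widehat{f\circ g}=\hat f\circ\hat g$ (where defined). The magnum of $A\subseteq\mathbb{N}$ is $m(A):=\widehat{\kappa_A}(\omega)$. -}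

module Defs where

open import Level using (Level; suc; _⊔_)
open import Data.Nat as ℕ using (ℕ; zero; _≤_)
open import Data.Bool using (Bool; true; false)
open import Data.Product using (Σ; ∃; _×_; _,_)
open import Relation.Binary.PropositionalEquality using (_≡_; refl)
import Data.Nat.Properties as NP
open import Relation.Binary.Structures using (IsStrictTotalOrder)
open import Relation.Nullary using (¬_)

-- A subset A ⊆ ℕ = {1,2,...} is given by its characteristic function
-- (only the values at n ≥ 1 are relevant; the value at 0 is ignored).
Subsetℕ : Set
Subsetℕ = ℕ → Bool

_∈ₛ_ : ℕ → Subsetℕ → Set
n ∈ₛ A = (1 ≤ n) × (A n ≡ true)

_⊂ₛ_ : Subsetℕ → Subsetℕ → Set
B ⊂ₛ A = (∀ n → n ∈ₛ B → n ∈ₛ A) × (∃ λ n → n ∈ₛ A × ¬ (n ∈ₛ B))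

κ : Subsetℕ → ℕ → ℕ
κ A zero = 0
κ A (ℕ.suc n) with A (ℕ.suc n)
... | true  = ℕ.suc (κ A n)
... | false = κ A n

Nondecreasing : (ℕ → ℕ) → Set
Nondecreasing f = ∀ m n → 1 ≤ m → m ≤ n → f m ≤ f n

Eventually : (ℕ → Set) → Set
Eventually P = ∃ λ N → ∀ n → N ≤ n → P n

record Surnaturals (c ℓ₁ ℓ₂ : Level) : Set (suc (c ⊔ ℓ₁ ⊔ ℓ₂)) where
  field
    Nn       : Set c
    _≈_      : Nn → Nn → Set ℓ₁
    _<_      : Nn → Nn → Set ℓ₂
    isSTO    : IsStrictTotalOrder _≈_ _<_
    _+_      : Nn → Nn → Nn
    _·_      : Nn → Nn → Nn
    ι        : ℕ → Nn
    ι-+      : ∀ m n → ι (m ℕ.+ n) ≈ (ι m + ι n)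
    ι-·      : ∀ m n → ι (m ℕ.* n) ≈ (ι m · ι n)
    ι-<      : ∀ m n → m ℕ.< n → ι m < ι n
    ω        : Nn
    ι<ω      : ∀ n → ι n < ω

  NotInℕ : Nn → Set ℓ₁
  NotInℕ ν = ¬ (∃ λ n → (1 ≤ n) × (ι n ≈ ν))

record Extension {c ℓ₁ ℓ₂} (S : Surnaturals c ℓ₁ ℓ₂) : Set (c ⊔ ℓ₁ ⊔ ℓ₂) where
  open Surnaturals S
  field
    ext      : (f : ℕ → ℕ) → Nondecreasing f → Nn → Nn
    ext-agree : ∀ f (p : Nondecreasing f) n → 1 ≤ n → ext f p (ι n) ≈ ι (f n)
    ext-eq   : ∀ f g (p : Nondecreasing f) (q : Nondecreasing g) →
               Eventually (λ n → f n ≡ g n) →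
               ∀ ν → NotInℕ ν → ext f p ν ≈ ext g q ν
    ext-<    : ∀ f g (p : Nondecreasing f) (q : Nondecreasing g) →
               Eventually (λ n → f n ℕ.< g n) →
               ∀ ν → NotInℕ ν → ext f p ν < ext g q ν
    ext-+    : ∀ f g (p : Nondecreasing f) (q : Nondecreasing g)
               (r : Nondecreasing (λ n → f n ℕ.+ g n)) →
               ∀ ν → ext (λ n → f n ℕ.+ g n) r ν ≈ (ext f p ν + ext g q ν)
    ext-·    : ∀ f g (p : Nondecreasing f) (q : Nondecreasing g)
               (r : Nondecreasing (λ n → f n ℕ.* g n)) →
               ∀ ν → ext (λ n → f n ℕ.* g n) r ν ≈ (ext f p ν · ext g q ν)
    -- f ∘ g is defined when g takes values in ℕ = {1,2,...}
    ext-∘    : ∀ f g (p : Nondecreasing f) (q : Nondecreasing g) →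
               (∀ n → 1 ≤ n → 1 ≤ g n) →
               (r : Nondecreasing (λ n → f (g n))) →
               ∀ ν → ext (λ n → f (g n)) r ν ≈ ext f p (ext g q ν)

κ-mono-suc : ∀ A n → κ A n ≤ κ A (ℕ.suc n)
κ-mono-suc A n with A (ℕ.suc n)
... | true  = NP.n≤1+n (κ A n)
... | false = NP.≤-refl

κ-mono-+ : ∀ A m k → κ A m ≤ κ A (m ℕ.+ k)
κ-mono-+ A m zero rewrite NP.+-identityʳ m = NP.≤-refl
κ-mono-+ A m (ℕ.suc k) rewrite NP.+-suc m k =
  NP.≤-trans (κ-mono-+ A m k) (κ-mono-suc A (m ℕ.+ k))

κ-nondecreasing : ∀ A → Nondecreasing (κ A)
κ-nondecreasing A m n _ m≤n with NP.m≤n⇒∃[o]m+o≡n m≤n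
... | k , refl = κ-mono-+ A m k

magnum : ∀ {c ℓ₁ ℓ₂} {S : Surnaturals c ℓ₁ ℓ₂} → Extension S → Subsetℕ → Surnaturals.Nn S
magnum {S = S} E A = Extension.ext E (κ A) (κ-nondecreasing A) (Surnaturals.ω S)

-- Proper inclusion B ⊂ A makes κ_B ≤ κ_A everywhere, and strictly smaller
-- from the first element of A ∖ B on; the Axiom of Extension transfers an
-- eventual strict inequality to every infinite surnatural, in particular ω.
module Submission where

open import Level using (Level)
open import Defs
open import Data.Nat using (ℕ; suc; _≤_; _<_; _≤′_; ≤′-refl; ≤′-step; s≤s; z≤n)
open import Data.Nat.Properties using (m≤n⇒m≤1+n; ≤⇒≤′)
open import Data.Bool using (true; false)
open import Data.Bool.Properties using (¬-not)
open import Data.Product using (_,_; proj₁; proj₂)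
open import Relation.Binary.PropositionalEquality using (_≡_; refl; sym; trans)
open import Relation.Binary.Structures using (IsStrictTotalOrder)

module _ {c ℓ₁ ℓ₂} (S : Surnaturals c ℓ₁ ℓ₂) where
  open Surnaturals S using (ω; ι<ω; isSTO; NotInℕ) renaming (_<_ to _<ₛ_)

  ω-NotInℕ : NotInℕ ω
  ω-NotInℕ (n , _ , ιn≈ω) = IsStrictTotalOrder.irrefl isSTO ιn≈ω (ι<ω n)

  magnum-< : (E : Extension S) {A B : Subsetℕ} →
             Eventually (λ n → κ B n < κ A n) → magnum E B <ₛ magnum E A
  magnum-< E {A} {B} κB<κA =
    Extension.ext-< E (κ B) (κ A) (κ-nondecreasing B) (κ-nondecreasing A)
      κB<κA ω ω-NotInℕ

module _ {A B : Subsetℕ} (B⊆A : ∀ n → 1 ≤ n → B n ≡ true → A n ≡ true) where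

  -- Stated for any relation closed under these two moves, so that ≤ and < share it.
  κ-step : (_R_ : ℕ → ℕ → Set) →
           (∀ {m n} → m R n → suc m R suc n) → (∀ {m n} → m R n → m R suc n) →
           ∀ n → κ B n R κ A n → κ B (suc n) R κ A (suc n)
  κ-step _ suc-R R-suc n r with A (suc n) in a | B (suc n) in b
  ... | true  | true  = suc-R r
  ... | true  | false = R-suc r
  ... | false | false = r
  ... | false | true  with () ← trans (sym a) (B⊆A (suc n) (s≤s z≤n) b)

  κ-mono-⊆ : ∀ n → κ B n ≤ κ A n
  κ-mono-⊆ 0       = z≤n
  κ-mono-⊆ (suc n) = κ-step _≤_ s≤s m≤n⇒m≤1+n n (κ-mono-⊆ n)

  κ-<-from : ∀ {n₀} → A (suc n₀) ≡ true → B (suc n₀) ≡ false →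
             ∀ {n} → suc n₀ ≤′ n → κ B n < κ A n
  κ-<-from {n₀} a b ≤′-refl rewrite a | b = s≤s (κ-mono-⊆ n₀)
  κ-<-from a b (≤′-step {n} n₀<n) = κ-step _<_ s≤s m≤n⇒m≤1+n n (κ-<-from a b n₀<n)

  κ-eventually-< : ∀ {n₀} → n₀ ∈ₛ A → B n₀ ≡ false → Eventually (λ n → κ B n < κ A n)
  κ-eventually-< {suc n₀} (_ , a) b = suc n₀ , λ n n₀<n → κ-<-from a b (≤⇒≤′ n₀<n)

theorem10 : ∀ {c ℓ₁ ℓ₂ : Level} (S : Surnaturals c ℓ₁ ℓ₂) (E : Extension S)
    (A B : Subsetℕ) → B ⊂ₛ A →
    Surnaturals._<_ S (magnum E B) (magnum E A)
theorem10 S E A B (B⊆A , n₀ , n₀∈A , n₀∉B) =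
  magnum-< S E (κ-eventually-< B⊆A′ n₀∈A Bn₀≡false)
  where
  B⊆A′ : ∀ n → 1 ≤ n → B n ≡ true → A n ≡ true
  B⊆A′ n 1≤n Bn = proj₂ (B⊆A n (1≤n , Bn))

  Bn₀≡false : B n₀ ≡ false
  Bn₀≡false = ¬-not (λ Bn₀ → n₀∉B (proj₁ n₀∈A , Bn₀))
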